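{- For every integer $k\ge 1$: (i) every quasi-bipartite graph with $k$ terminals admits an exact (quality-$1$) contraction-based cut sparsifier with $2^{O(k^2\log k)}$ vertices; and (ii) there exists a quasi-bipartite graph with $k$ terminals every exact contraction-based cut sparsifier of which contains $\Omega(2^k)$ vertices.
   Context: Graphs are undirected with positive edge weights (capacities); $T\subseteq V(G)$ is the terminal set, $|T|=k$. A graph is quasi-bipartite (with respect to $T$) if every edge is incident to some terminal, i.e., there is no edge between two non-terminals. For a partition $(T_1,T_2)$ of $T$ into non-empty subsets, $\mathrm{mincut}_G(T_1,T_2)$ is the minimum total weight of an edge set whose removal disconnects $T_1$ from $T_2$. A graph $H$ is a contraction-based sparsifier of $G$ with respect to $T$ if there is a partition $\mathcal L$ of $V(G)$ in which distinct terminals lie in distinct parts, and $H$ is obtained from $G$ by contracting each part $L\in\mathcal L$ into a single vertex, keeping parallel edges and discarding self-loops. It is an exact cut sparsifier if $\mathrm{mincut}_H(T_1,T_2)=\mathrm{mincut}_G(T_1,T_2)$ for every partition $(T_1,T_2)$ of $T$ into non-empty subsets.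
   Formalization: The edge weights (capacities) of the graphs are positive rationals. -}

module Defs where

open import Data.Nat using (ℕ; zero; suc)
open import Data.Fin using (Fin; zero; suc; _≟_)
open import Data.Bool using (Bool; true; false)
open import Data.List using (List; []; _∷_; length; lookup; map; filter)
open import Data.List.Relation.Unary.All using (All)
open import Data.Rational using (ℚ; 0ℚ; _+_; _<_; _≤_)
open import Data.Product using (Σ; ∃; _×_; _,_; proj₁; proj₂)
open import Data.Sum using (_⊎_)
open import Relation.Binary.PropositionalEquality using (_≡_; _≢_)
open import Relation.Nullary using (¬_)
open import Relation.Nullary.Decidable using (¬?)
open import Function using (_∘_)
open import Function.Definitions using (Injective)

-- An undirected weighted edge between two vertices of Fin n, with capacity.
record Edge (n : ℕ) : Set where
  constructor edge
  field
    src : Fin n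
    tgt : Fin n
    cap : ℚ
open Edge public

Graph : ℕ → Set
Graph n = List (Edge n)

PositiveWeights : ∀ {n} → Graph n → Set
PositiveWeights G = All (λ e → 0ℚ < cap e) G

-- terminal set T given by an injective map term : Fin k → Fin n
IsTerminal : ∀ {n k} → (Fin k → Fin n) → Fin n → Set
IsTerminal {k = k} term v = Σ (Fin k) λ i → term i ≡ v

QuasiBipartite : ∀ {n k} → Graph n → (Fin k → Fin n) → Set
QuasiBipartite G term = All (λ e → IsTerminal term (src e) ⊎ IsTerminal term (tgt e)) G

-- an edge set of G: a marking (true = removed) of the edges of G
EdgeSet : ∀ {n} → Graph n → Set
EdgeSet G = Fin (length G) → Bool

weight : ∀ {n} (G : Graph n) → EdgeSet G → ℚ
weight [] F = 0ℚ
weight (e ∷ G) F with F zero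
... | true  = cap e + weight G (F ∘ suc)
... | false = weight G (F ∘ suc)

Joins : ∀ {n} → Edge n → Fin n → Fin n → Set
Joins e x y = (src e ≡ x × tgt e ≡ y) ⊎ (src e ≡ y × tgt e ≡ x)

data Reach {n} (G : Graph n) (F : EdgeSet G) (u : Fin n) : Fin n → Set where
  here : Reach G F u u
  step : ∀ {x y} (i : Fin (length G)) → F i ≡ false →
         Joins (lookup G i) x y → Reach G F u x → Reach G F u y

-- a bipartition (T1,T2) of the terminals: side i ≡ true means i ∈ T1
NontrivialSide : ∀ {k} → (Fin k → Bool) → Set
NontrivialSide {k} side = (Σ (Fin k) λ i → side i ≡ true) × (Σ (Fin k) λ j → side j ≡ false)

Disconnects : ∀ {n k} (G : Graph n) (term : Fin k → Fin n) (side : Fin k → Bool) → EdgeSet G → Set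
Disconnects G term side F =
  ∀ i j → side i ≡ true → side j ≡ false → ¬ Reach G F (term i) (term j)

IsMinCut : ∀ {n k} (G : Graph n) (term : Fin k → Fin n) (side : Fin k → Bool) → ℚ → Set
IsMinCut G term side c =
  (Σ (EdgeSet G) λ F → Disconnects G term side F × weight G F ≡ c) ×
  (∀ (F : EdgeSet G) → Disconnects G term side F → c ≤ weight G F)

-- contraction along f : Fin n → Fin n' (parts = fibres of f);
-- parallel edges kept, self-loops discarded
contract : ∀ {n n'} → (Fin n → Fin n') → Graph n → Graph n'
contract f G =
  map (λ e → edge (f (src e)) (f (tgt e)) (cap e))
      (filter (λ e → ¬? (f (src e) ≟ f (tgt e))) G)

-- f describes a partition of V(G) into (non-empty) parts, distinct terminals in distinct parts
IsTerminalSeparatingPartition : ∀ {n n' k} → (Fin k → Fin n) → (Fin n → Fin n') → Set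
IsTerminalSeparatingPartition {n} term f =
  (∀ y → Σ (Fin n) λ x → f x ≡ y) × Injective _≡_ _≡_ (f ∘ term)

ExactCutSparsifier : ∀ {n n' k} (G : Graph n) (term : Fin k → Fin n)
                     (H : Graph n') (termH : Fin k → Fin n') → Set
ExactCutSparsifier G term H termH =
  ∀ side → NontrivialSide side →
    Σ ℚ λ c → IsMinCut G term side c × IsMinCut H termH side c

{-# OPTIONS --safe #-}
module Submission where

-- Fix a side s : Fin k → Bool of the terminals. In a quasi-bipartite graph a non-terminal v is
-- adjacent to terminals only, so moving v from side false to side true lowers the cut by
-- gain(v) = Σ_{e ∋ v} cap e · (±1 according to the side of the other end of e), a linear form in
-- the ±1-encoded side s that does not depend on the other non-terminals. Hence putting every
-- non-terminal v on side [gain(v) ≥ 0] gives a minimum cut, and the side of v is a linear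
-- threshold function of s. By Chow's theorem such a function is determined by its k + 1 Chow
-- parameters (the number of sides it accepts and, for each i, the number of accepted sides with
-- s i = true), each at most 2^k: a threshold function maximises the correlation Σ_s [q s] · h s
-- among Boolean functions q, and for linear h this correlation depends only on the Chow
-- parameters of q. Contracting non-terminals with equal Chow parameters therefore keeps the
-- optimal labelling well defined for every side, so all minimum terminal cuts survive, and at most
-- k + (2^k + 1)^(k+1) = 2^O(k² log k) vertices remain.
--
-- For the lower bound take terminals A, B, E, T₀, …, T_{m-1} and a non-terminal v_j for every
-- j < 2^m, joined by unit edges to E, A, B and, for every bit i set in j, to A and to T_i. A minimum
-- cut of an exact contraction sparsifier pulls back to a minimum cut of G, which must put each v_j
-- on the side given by the sign of its gain. For a singleton side that gain is negative, so no v_j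
-- is merged with a terminal; for the side {A, T_i} its sign is bit i of j, so no two v_j are
-- merged. Hence at least 2^m = 2^k / 8 vertices remain.

open import Defs
open import Data.Bool using (Bool; true; false; not; _∧_; _∨_; _xor_; if_then_else_)
import Data.Bool.Properties as Boolₚ
open import Data.Empty using (⊥-elim)
open import Data.Fin as Fin using (Fin; zero; suc; _≟_; _↑ˡ_; _↑ʳ_)
import Data.Fin.Properties as Finₚ
open import Data.List using (List; []; _∷_; _++_; length; lookup; map; concatMap; allFin)
open import Data.List.Properties using (map-tabulate)
open import Data.List.Membership.Propositional using (_∈_)
open import Data.List.Membership.Propositional.Properties using (∈-lookup)
open import Data.List.Relation.Unary.All as All using (All; []; _∷_)
open import Data.List.Relation.Unary.Any using (here; there)
open import Data.Nat as ℕ using (ℕ; zero; suc)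
open import Data.Product using (Σ; ∃; _×_; _,_; proj₁; proj₂)
open import Data.Sum using (_⊎_; inj₁; inj₂)
open import Function using (_∘_; id)
open import Function.Definitions using (Injective)
open import Relation.Binary.PropositionalEquality
open import Relation.Nullary using (¬_; Dec; yes; no; does; contradiction)

↑ˡ≢↑ʳ : ∀ {k m} (i : Fin k) (j : Fin m) → i ↑ˡ m ≢ k ↑ʳ j
↑ˡ≢↑ʳ {k} {m} i j eq with trans (sym (Finₚ.splitAt-↑ˡ k i m)) (trans (cong (Fin.splitAt k) eq) (Finₚ.splitAt-↑ʳ k m j))
... | ()

record ImageFactorisation {n N} (g : Fin n → Fin N) : Set where
  field
    size       : ℕ
    surjection : Fin n → Fin size
    injection  : Fin size → Fin N
    surjective : ∀ y → ∃ λ x → surjection x ≡ y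
    injective  : Injective _≡_ _≡_ injection
    factors    : ∀ x → injection (surjection x) ≡ g x

factorise : ∀ {n N} (g : Fin n → Fin N) → ImageFactorisation g
factorise {zero}  g = record
  { size = 0 ; surjection = λ () ; injection = λ () ; surjective = λ ()
  ; injective = λ {x} → ⊥-elim (Finₚ.¬Fin0 x) ; factors = λ () }
factorise {suc n} {N} g with factorise (g ∘ suc) | Finₚ.any? (λ x → g (suc x) ≟ g zero)
... | F | yes (x₀ , g₀≡) = record
  { size = size ; surjection = surjection′ ; injection = injection
  ; surjective = λ y → suc (proj₁ (surjective y)) , proj₂ (surjective y)
  ; injective = injective ; factors = factors′ }
  where
  open ImageFactorisation F
  surjection′ : Fin (suc n) → Fin size
  surjection′ zero    = surjection x₀
  surjection′ (suc x) = surjection x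
  factors′ : ∀ x → injection (surjection′ x) ≡ g x
  factors′ zero    = trans (factors x₀) g₀≡
  factors′ (suc x) = factors x
... | F | no g₀-new = record
  { size = suc size ; surjection = surjection′ ; injection = injection′
  ; surjective = surjective′ ; injective = injective′ ; factors = factors′ }
  where
  open ImageFactorisation F
  surjection′ : Fin (suc n) → Fin (suc size)
  surjection′ zero    = zero
  surjection′ (suc x) = suc (surjection x)
  injection′ : Fin (suc size) → Fin N
  injection′ zero    = g zero
  injection′ (suc y) = injection y
  surjective′ : ∀ y → ∃ λ x → surjection′ x ≡ y
  surjective′ zero    = zero , refl
  surjective′ (suc y) = suc (proj₁ (surjective y)) , cong suc (proj₂ (surjective y))
  g₀≢ : ∀ y → g zero ≢ injection y
  g₀≢ y eq = let x , fx≡y = surjective y in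
    g₀-new (x , sym (trans eq (trans (cong injection (sym fx≡y)) (factors x))))
  injective′ : Injective _≡_ _≡_ injection′
  injective′ {zero}  {zero}  _  = refl
  injective′ {zero}  {suc y} eq = contradiction eq (g₀≢ y)
  injective′ {suc x} {zero}  eq = contradiction (sym eq) (g₀≢ x)
  injective′ {suc x} {suc y} eq = cong suc (injective eq)
  factors′ : ∀ x → injection′ (surjection′ x) ≡ g x
  factors′ zero    = refl
  factors′ (suc x) = factors x

funToFin-cong : ∀ {m n} {g h : Fin m → Fin n} → g ≗ h → Fin.funToFin g ≡ Fin.funToFin h
funToFin-cong {m = zero}  _   = refl
funToFin-cong {m = suc m} g≗h = cong₂ Fin.combine (g≗h zero) (funToFin-cong (g≗h ∘ suc))

module SizeBound where
  open import Data.Nat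
  open import Data.Nat.Properties
  open import Data.Nat.Logarithm using (⌊log₂_⌋)
  open import Data.Nat.Solver using (module +-*-Solver)
  open +-*-Solver using (solve; _:+_; _:*_; _:=_; con)

  n<2^n : ∀ n → n < 2 ^ n
  n<2^n zero    = s≤s z≤n
  n<2^n (suc n) = ≤-trans (≤-reflexive (+-comm 1 (suc n)))
                          (+-mono-≤ (n<2^n n) (≤-trans (m^n>0 2 n) (m≤m+n (2 ^ n) 0)))

  1+2^n≤2^[1+n] : ∀ n → suc (2 ^ n) ≤ 2 ^ suc n
  1+2^n≤2^[1+n] n = ≤-trans (≤-reflexive (+-comm 1 (2 ^ n)))
                            (+-monoʳ-≤ (2 ^ n) (≤-trans (m^n>0 2 n) (m≤m+n (2 ^ n) 0)))

  [2+j]²+1≤5[1+j]² : ∀ j → suc (suc (suc j) * suc (suc j)) ≤ 5 * (suc j * suc j)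
  [2+j]²+1≤5[1+j]² j = ≤-trans (m≤m+n _ (4 * (j * j) + 6 * j)) (≤-reflexive (identity j))
    where
    identity : ∀ j → suc (suc (suc j) * suc (suc j)) + (4 * (j * j) + 6 * j) ≡ 5 * (suc j * suc j)
    identity = solve 1 (λ j → (con 1 :+ (con 2 :+ j) :* (con 2 :+ j)) :+ (con 4 :* (j :* j) :+ con 6 :* j)
                             := con 5 :* ((con 1 :+ j) :* (con 1 :+ j))) refl

  class-bound : ∀ k → 1 ≤ k → k + suc (2 ^ k) ^ suc k ≤ 2 ^ (5 * (k * k * (1 + ⌊log₂ k ⌋)))
  class-bound k@(suc j) _ = begin
    k + suc (2 ^ k) ^ suc k               ≤⟨ +-mono-≤ k≤2^E classes≤2^E ⟩
    2 ^ E + 2 ^ E                         ≡⟨ cong (2 ^ E +_) (+-identityʳ (2 ^ E)) ⟨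
    2 ^ suc E                             ≤⟨ ^-monoʳ-≤ 2 1+E≤ ⟩
    2 ^ (5 * (k * k * (1 + ⌊log₂ k ⌋)))   ∎
    where
    open ≤-Reasoning
    E = suc k * suc k
    k≤2^E : k ≤ 2 ^ E
    k≤2^E = <⇒≤ (<-≤-trans (n<2^n k) (^-monoʳ-≤ 2 (≤-trans (n≤1+n k) (m≤m*n (suc k) (suc k)))))
    classes≤2^E : suc (2 ^ k) ^ suc k ≤ 2 ^ E
    classes≤2^E = ≤-trans (^-monoˡ-≤ (suc k) (1+2^n≤2^[1+n] k)) (≤-reflexive (^-*-assoc 2 (suc k) (suc k)))
    1+E≤ : suc E ≤ 5 * (k * k * (1 + ⌊log₂ k ⌋))
    1+E≤ = ≤-trans ([2+j]²+1≤5[1+j]² j) (*-monoʳ-≤ 5 (m≤m*n (k * k) (1 + ⌊log₂ k ⌋)))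

module RationalLemmas where
  open import Data.Rational using (0ℚ; 1ℚ; _+_; _*_; -_; _≤_; _<_)
  open import Data.Rational.Properties

  c≡0+c*1 : ∀ c → c ≡ 0ℚ + c * 1ℚ
  c≡0+c*1 c = sym (trans (+-identityˡ (c * 1ℚ)) (*-identityʳ c))

  0≡c+c*-1 : ∀ c → 0ℚ ≡ c + c * - 1ℚ
  0≡c+c*-1 c = begin
    0ℚ                ≡⟨ +-inverseʳ c ⟨
    c + - c           ≡⟨ cong (λ x → c + - x) (*-identityʳ c) ⟨
    c + - (c * 1ℚ)    ≡⟨ cong (c +_) (neg-distribʳ-* c 1ℚ) ⟩
    c + c * - 1ℚ      ∎
    where open ≡-Reasoning

  x≤x+y : ∀ x {y} → 0ℚ ≤ y → x ≤ x + y
  x≤x+y x {y} 0≤y = ≤-trans (≤-reflexive (sym (+-identityʳ x))) (+-monoʳ-≤ x 0≤y)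

  x+y≤x : ∀ x {y} → y ≤ 0ℚ → x + y ≤ x
  x+y≤x x {y} y≤0 = ≤-trans (+-monoʳ-≤ x y≤0) (≤-reflexive (+-identityʳ x))

  x<x+y : ∀ x {y} → 0ℚ < y → x < x + y
  x<x+y x {y} 0<y = ≤-<-trans (≤-reflexive (sym (+-identityʳ x))) (+-monoʳ-< x 0<y)

  x+y<x : ∀ x {y} → y < 0ℚ → x + y < x
  x+y<x x {y} y<0 = <-≤-trans (+-monoʳ-< x y<0) (≤-reflexive (+-identityʳ x))

module Sums where
  private variable
    A B : Set

  open import Algebra.Bundles using (CommutativeMonoid)
  open import Data.Rational using (ℚ; 0ℚ; 1ℚ; _+_; _*_; -_; _≤_; _<_)
  open import Data.Rational.Properties
  open import Algebra.Properties.CommutativeSemigroup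
    (CommutativeMonoid.commutativeSemigroup +-0-commutativeMonoid) using (interchange)

  ∑ : List A → (A → ℚ) → ℚ
  ∑ []       f = 0ℚ
  ∑ (x ∷ xs) f = f x + ∑ xs f

  module _ {f g : A → ℚ} where

    ∑-cong-All : ∀ {xs} → All (λ x → f x ≡ g x) xs → ∑ xs f ≡ ∑ xs g
    ∑-cong-All []         = refl
    ∑-cong-All (eq ∷ eqs) = cong₂ _+_ eq (∑-cong-All eqs)

    ∑-cong : ∀ xs → f ≗ g → ∑ xs f ≡ ∑ xs g
    ∑-cong xs eq = ∑-cong-All (All.universal eq xs)

    ∑-+ : ∀ xs → ∑ xs (λ x → f x + g x) ≡ ∑ xs f + ∑ xs g
    ∑-+ []       = sym (+-identityˡ 0ℚ)
    ∑-+ (x ∷ xs) = trans (cong (f x + g x +_) (∑-+ xs)) (interchange (f x) (g x) (∑ xs f) (∑ xs g))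

    ∑-mono-≤ : ∀ xs → (∀ x → f x ≤ g x) → ∑ xs f ≤ ∑ xs g
    ∑-mono-≤ []       _  = ≤-refl
    ∑-mono-≤ (x ∷ xs) le = +-mono-≤ (le x) (∑-mono-≤ xs le)

    ∑-mono-< : ∀ xs → (∀ x → f x ≤ g x) → ∀ {x} → x ∈ xs → f x < g x → ∑ xs f < ∑ xs g
    ∑-mono-< (y ∷ xs) le (here refl) lt = +-mono-<-≤ lt (∑-mono-≤ xs le)
    ∑-mono-< (y ∷ xs) le (there x∈)  lt = +-mono-≤-< (le y) (∑-mono-< xs le x∈ lt)

  ∑-*ˡ : ∀ xs c (f : A → ℚ) → ∑ xs (λ x → c * f x) ≡ c * ∑ xs f
  ∑-*ˡ []       c f = sym (*-zeroʳ c)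
  ∑-*ˡ (x ∷ xs) c f = trans (cong (c * f x +_) (∑-*ˡ xs c f)) (sym (*-distribˡ-+ c (f x) (∑ xs f)))

  ∑-neg : ∀ xs (f : A → ℚ) → ∑ xs (λ x → - f x) ≡ - ∑ xs f
  ∑-neg []       f = refl
  ∑-neg (x ∷ xs) f = trans (cong (- f x +_) (∑-neg xs f)) (sym (neg-distrib-+ (f x) (∑ xs f)))

  ∑-++ : ∀ xs ys (f : A → ℚ) → ∑ (xs ++ ys) f ≡ ∑ xs f + ∑ ys f
  ∑-++ []       ys f = sym (+-identityˡ _)
  ∑-++ (x ∷ xs) ys f = trans (cong (f x +_) (∑-++ xs ys f)) (sym (+-assoc (f x) (∑ xs f) (∑ ys f)))

  ∑-concatMap : ∀ (h : A → List B) xs (f : B → ℚ) → ∑ (concatMap h xs) f ≡ ∑ xs (λ x → ∑ (h x) f)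
  ∑-concatMap h []       f = refl
  ∑-concatMap h (x ∷ xs) f = trans (∑-++ (h x) (concatMap h xs) f) (cong (∑ (h x) f +_) (∑-concatMap h xs f))

  ∑-zero : ∀ xs {f : A → ℚ} → (∀ x → f x ≡ 0ℚ) → ∑ xs f ≡ 0ℚ
  ∑-zero []       _    = refl
  ∑-zero (x ∷ xs) f≡0 = trans (cong₂ _+_ (f≡0 x) (∑-zero xs f≡0)) (+-identityˡ 0ℚ)

  ∑-nonneg : ∀ xs {f : A → ℚ} → (∀ x → 0ℚ ≤ f x) → 0ℚ ≤ ∑ xs f
  ∑-nonneg xs nonneg = subst (_≤ ∑ xs _) (∑-zero xs λ _ → refl) (∑-mono-≤ xs nonneg)

  ∑-nonpos : ∀ xs {f : A → ℚ} → (∀ x → f x ≤ 0ℚ) → ∑ xs f ≤ 0ℚ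
  ∑-nonpos xs nonpos = subst (∑ xs _ ≤_) (∑-zero xs λ _ → refl) (∑-mono-≤ xs nonpos)

  term≤∑ : ∀ xs {f : A → ℚ} → (∀ x → 0ℚ ≤ f x) → ∀ {x} → x ∈ xs → f x ≤ ∑ xs f
  term≤∑ (y ∷ xs) {f} nonneg (here refl) = begin
    f y          ≡⟨ +-identityʳ (f y) ⟨
    f y + 0ℚ     ≤⟨ +-monoʳ-≤ (f y) (∑-nonneg xs nonneg) ⟩
    f y + ∑ xs f ∎
    where open ≤-Reasoning
  term≤∑ (y ∷ xs) {f} nonneg (there x∈) = begin
    f _          ≤⟨ term≤∑ xs nonneg x∈ ⟩
    ∑ xs f       ≡⟨ +-identityˡ (∑ xs f) ⟨
    0ℚ + ∑ xs f  ≤⟨ +-monoˡ-≤ (∑ xs f) (nonneg y) ⟩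
    f y + ∑ xs f ∎
    where open ≤-Reasoning

  ∑-map : ∀ (h : A → B) xs (f : B → ℚ) → ∑ (map h xs) f ≡ ∑ xs (f ∘ h)
  ∑-map h []       f = refl
  ∑-map h (x ∷ xs) f = cong (f (h x) +_) (∑-map h xs f)

  ∑-allFin-suc : ∀ N (f : Fin (suc N) → ℚ) → ∑ (allFin (suc N)) f ≡ f zero + ∑ (allFin N) (f ∘ suc)
  ∑-allFin-suc N f = cong (f zero +_)
    (trans (cong (λ xs → ∑ xs f) (sym (map-tabulate id suc))) (∑-map suc (allFin N) f))

  ∑-allFin-δ : ∀ N (f : Fin N → ℚ) j → (∀ j' → j' ≢ j → f j' ≡ 0ℚ) → ∑ (allFin N) f ≡ f j
  ∑-allFin-δ (suc N) f zero    δ = begin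
    ∑ (allFin (suc N)) f               ≡⟨ ∑-allFin-suc N f ⟩
    f zero + ∑ (allFin N) (f ∘ suc)    ≡⟨ cong (f zero +_) (∑-zero (allFin N) (λ j' → δ (suc j') λ ())) ⟩
    f zero + 0ℚ                        ≡⟨ +-identityʳ (f zero) ⟩
    f zero                             ∎
    where open ≡-Reasoning
  ∑-allFin-δ (suc N) f (suc j) δ = begin
    ∑ (allFin (suc N)) f               ≡⟨ ∑-allFin-suc N f ⟩
    f zero + ∑ (allFin N) (f ∘ suc)    ≡⟨ cong₂ _+_ (δ zero λ ()) (∑-allFin-δ N (f ∘ suc) j (λ j' j'≢j → δ (suc j') (j'≢j ∘ Finₚ.suc-injective))) ⟩
    0ℚ + f (suc j)                     ≡⟨ +-identityˡ (f (suc j)) ⟩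
    f (suc j)                          ∎
    where open ≡-Reasoning

  count : List A → (A → Bool) → ℕ
  count []       p = 0
  count (x ∷ xs) p = if p x then suc (count xs p) else count xs p

  count≤length : ∀ xs (p : A → Bool) → count xs p ℕ.≤ length xs
  count≤length []       p = ℕ.z≤n
  count≤length (x ∷ xs) p with p x
  ... | true  = ℕ.s≤s (count≤length xs p)
  ... | false = Data.Nat.Properties.m≤n⇒m≤1+n (count≤length xs p)
    where import Data.Nat.Properties

  fromℕ : ℕ → ℚ
  fromℕ zero    = 0ℚ
  fromℕ (suc n) = 1ℚ + fromℕ n

  ∑-indicator : ∀ xs (p : A → Bool) → ∑ xs (λ x → if p x then 1ℚ else 0ℚ) ≡ fromℕ (count xs p)
  ∑-indicator []       p = refl
  ∑-indicator (x ∷ xs) p with p x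
  ... | true  = cong (1ℚ +_) (∑-indicator xs p)
  ... | false = trans (+-identityˡ _) (∑-indicator xs p)

module ChowTheorem where
  private variable
    A : Set
    k : ℕ

  open import Data.Rational using (ℚ; 0ℚ; 1ℚ; _+_; _*_; -_; _-_; _≤_; _<_; _≤?_)
  open import Data.Rational.Properties
  open import Data.List.Membership.Propositional.Properties using (∈-++⁺ˡ; ∈-++⁺ʳ; ∈-map⁺)
  import Data.List.Properties as Listₚ
  import Data.Nat.Properties as ℕₚ
  import Data.Vec.Functional as Vector
  open import Function.Bundles using (mk⇔)
  open Sums

  sign : Bool → ℚ
  sign true  = 1ℚ
  sign false = - 1ℚ

  isNonNeg : ℚ → Bool
  isNonNeg q = does (0ℚ ≤? q)

  threshold : (A → ℚ) → A → Bool
  threshold h = isNonNeg ∘ h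

  threshold-maximises : ∀ (h : A → ℚ) x b → (if b then h x else 0ℚ) ≤ (if threshold h x then h x else 0ℚ)
  threshold-maximises h x = maximises (0ℚ ≤? h x)
    where maximises : (d : Dec (0ℚ ≤ h x)) → ∀ b → (if b then h x else 0ℚ) ≤ (if does d then h x else 0ℚ)
          maximises (yes _)    true  = ≤-refl
          maximises (yes 0≤hx) false = 0≤hx
          maximises (no  0≰hx) true  = <⇒≤ (≰⇒> 0≰hx)
          maximises (no  _)    false = ≤-refl

  threshold-strict : ∀ (h : A → ℚ) x → threshold h x ≡ false → h x < (if threshold h x then h x else 0ℚ)
  threshold-strict h x = strict (0ℚ ≤? h x)
    where strict : (d : Dec (0ℚ ≤ h x)) → does d ≡ false → h x < (if does d then h x else 0ℚ)
          strict (no 0≰hx) _ = ≰⇒> 0≰hx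

  maximal-correlation⇒⊆threshold : ∀ xs (h : A → ℚ) (q : A → Bool) →
    ∑ xs (λ x → if q x then h x else 0ℚ) ≡ ∑ xs (λ x → if threshold h x then h x else 0ℚ) →
    ∀ {x} → x ∈ xs → q x ≡ true → threshold h x ≡ true
  maximal-correlation⇒⊆threshold xs h q eq {x} x∈ qx with threshold h x in θx
  ... | true  = refl
  ... | false = contradiction (∑-mono-< xs (λ y → threshold-maximises h y (q y)) x∈ strict) (<-irrefl eq)
    where strict : (if q x then h x else 0ℚ) < (if threshold h x then h x else 0ℚ)
          strict = subst (λ b → (if b then h x else 0ℚ) < _) (sym qx) (threshold-strict h x θx)

  cube : ∀ k → List (Fin k → Bool)
  cube zero    = Vector.[] ∷ []
  cube (suc k) = map (true Vector.∷_) (cube k) ++ map (false Vector.∷_) (cube k)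

  length-cube : ∀ k → length (cube k) ≡ 2 ℕ.^ k
  length-cube zero    = refl
  length-cube (suc k) = begin
    length (map (true Vector.∷_) (cube k) ++ map (false Vector.∷_) (cube k))
      ≡⟨ Listₚ.length-++ (map (true Vector.∷_) (cube k)) ⟩
    length (map (true Vector.∷_) (cube k)) ℕ.+ length (map (false Vector.∷_) (cube k))
      ≡⟨ cong₂ ℕ._+_ (Listₚ.length-map _ (cube k)) (Listₚ.length-map _ (cube k)) ⟩
    length (cube k) ℕ.+ length (cube k)
      ≡⟨ cong (λ m → m ℕ.+ m) (length-cube k) ⟩
    2 ℕ.^ k ℕ.+ 2 ℕ.^ k
      ≡⟨ cong (2 ℕ.^ k ℕ.+_) (sym (ℕₚ.+-identityʳ (2 ℕ.^ k))) ⟩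
    2 ℕ.^ suc k ∎
    where open ≡-Reasoning

  -- Only up to ≗, as there is no function extensionality.
  cube-complete : ∀ {k} (s : Fin k → Bool) → ∃ λ s' → s' ∈ cube k × s' ≗ s
  cube-complete {zero}  s = Vector.[] , here refl , λ ()
  cube-complete {suc k} s with cube-complete (s ∘ suc) | s zero in s₀
  ... | s' , s'∈ , s'≗ | true  = true Vector.∷ s' , ∈-++⁺ˡ (∈-map⁺ _ s'∈) , λ { zero → sym s₀ ; (suc i) → s'≗ i }
  ... | s' , s'∈ , s'≗ | false = false Vector.∷ s' , ∈-++⁺ʳ _ (∈-map⁺ _ s'∈) , λ { zero → sym s₀ ; (suc i) → s'≗ i }

  LinearForm : ℕ → Set
  LinearForm k = List (ℚ × Fin k)

  ⟦_⟧ : LinearForm k → (Fin k → Bool) → ℚ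
  ⟦ φ ⟧ s = ∑ φ λ { (c , i) → c * sign (s i) }

  ⟦⟧-cong : ∀ (φ : LinearForm k) {s s'} → s ≗ s' → ⟦ φ ⟧ s ≡ ⟦ φ ⟧ s'
  ⟦⟧-cong φ eq = ∑-cong φ λ { (c , i) → cong (λ b → c * sign b) (eq i) }

  chow : ((Fin k → Bool) → Bool) → Fin (suc k) → ℕ
  chow {k} p zero    = count (cube k) p
  chow {k} p (suc i) = count (cube k) (λ s → p s ∧ s i)

  chow≤length : ∀ {k} (p : (Fin k → Bool) → Bool) j → chow p j ℕ.≤ length (cube k)
  chow≤length {k} p zero    = count≤length (cube k) p
  chow≤length {k} p (suc i) = count≤length (cube k) (λ s → p s ∧ s i)

  correlation : ((Fin k → Bool) → Bool) → ((Fin k → Bool) → ℚ) → ℚ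
  correlation {k} p h = ∑ (cube k) (λ s → if p s then h s else 0ℚ)

  module _ {k} (p : (Fin k → Bool) → Bool) where

    signedCount : Fin k → ℚ
    signedCount i = (fromℕ (chow p (suc i)) + fromℕ (chow p (suc i))) - fromℕ (chow p zero)

    correlation-sign : ∀ i → correlation p (λ s → sign (s i)) ≡ signedCount i
    correlation-sign i = begin
      correlation p (λ s → sign (s i))
        ≡⟨ ∑-cong (cube k) (λ s → split (p s) (s i)) ⟩
      ∑ (cube k) (λ s → (ind (p s ∧ s i) + ind (p s ∧ s i)) + - ind (p s))
        ≡⟨ ∑-+ (cube k) ⟩
      ∑ (cube k) (λ s → ind (p s ∧ s i) + ind (p s ∧ s i)) + ∑ (cube k) (λ s → - ind (p s))
        ≡⟨ cong₂ _+_ (∑-+ (cube k)) (∑-neg (cube k) (ind ∘ p)) ⟩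
      (∑ (cube k) (λ s → ind (p s ∧ s i)) + ∑ (cube k) (λ s → ind (p s ∧ s i))) - ∑ (cube k) (ind ∘ p)
        ≡⟨ cong₂ (λ a b → (a + a) - b) (∑-indicator (cube k) _) (∑-indicator (cube k) p) ⟩
      signedCount i ∎
      where
      open ≡-Reasoning
      ind : Bool → ℚ
      ind b = if b then 1ℚ else 0ℚ
      split : ∀ b x → (if b then sign x else 0ℚ) ≡ (ind (b ∧ x) + ind (b ∧ x)) + - ind b
      split true  true  = refl
      split true  false = refl
      split false x     = refl

    correlation-+ : ∀ (f g : (Fin k → Bool) → ℚ) →
                    correlation p (λ s → f s + g s) ≡ correlation p f + correlation p g
    correlation-+ f g = trans (∑-cong (cube k) (λ s → split (p s) s)) (∑-+ (cube k))
      where split : ∀ b s → (if b then f s + g s else 0ℚ) ≡ (if b then f s else 0ℚ) + (if b then g s else 0ℚ)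
            split true  s = refl
            split false s = refl

    correlation-*ˡ : ∀ c (f : (Fin k → Bool) → ℚ) → correlation p (λ s → c * f s) ≡ c * correlation p f
    correlation-*ˡ c f = trans (∑-cong (cube k) (λ s → split (p s) s)) (∑-*ˡ (cube k) c _)
      where split : ∀ b s → (if b then c * f s else 0ℚ) ≡ c * (if b then f s else 0ℚ)
            split true  s = refl
            split false s = sym (*-zeroʳ c)

    correlation-linear : ∀ (φ : LinearForm k) → correlation p ⟦ φ ⟧ ≡ ∑ φ λ { (c , i) → c * signedCount i }
    correlation-linear []            = ∑-zero (cube k) λ s → zero-if (p s)
      where zero-if : ∀ b → (if b then 0ℚ else 0ℚ) ≡ 0ℚ
            zero-if true  = refl
            zero-if false = refl
    correlation-linear ((c , i) ∷ φ) = begin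
      correlation p (λ s → c * sign (s i) + ⟦ φ ⟧ s)
        ≡⟨ correlation-+ (λ s → c * sign (s i)) ⟦ φ ⟧ ⟩
      correlation p (λ s → c * sign (s i)) + correlation p ⟦ φ ⟧
        ≡⟨ cong₂ _+_ (trans (correlation-*ˡ c (λ s → sign (s i))) (cong (c *_) (correlation-sign i)))
                     (correlation-linear φ) ⟩
      c * signedCount i + ∑ φ (λ { (c , i) → c * signedCount i }) ∎
      where open ≡-Reasoning

  same-chow⇒same-correlation : ∀ {k} (p q : (Fin k → Bool) → Bool) → chow p ≗ chow q →
                               ∀ φ → correlation p ⟦ φ ⟧ ≡ correlation q ⟦ φ ⟧
  same-chow⇒same-correlation p q p≗q φ = begin
    correlation p ⟦ φ ⟧                        ≡⟨ correlation-linear p φ ⟩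
    ∑ φ (λ { (c , i) → c * signedCount p i }) ≡⟨ ∑-cong φ (λ { (c , i) → cong (c *_) (same-signedCount i) }) ⟩
    ∑ φ (λ { (c , i) → c * signedCount q i }) ≡⟨ correlation-linear q φ ⟨
    correlation q ⟦ φ ⟧                        ∎
    where
    open ≡-Reasoning
    same-signedCount : ∀ i → signedCount p i ≡ signedCount q i
    same-signedCount i = cong₂ (λ a b → (fromℕ a + fromℕ a) - fromℕ b) (p≗q (suc i)) (p≗q zero)

  chow-⊆ : ∀ {k} (φ ψ : LinearForm k) → chow (threshold ⟦ φ ⟧) ≗ chow (threshold ⟦ ψ ⟧) →
           ∀ s → threshold ⟦ ψ ⟧ s ≡ true → threshold ⟦ φ ⟧ s ≡ true
  chow-⊆ φ ψ φ≗ψ s ψs with cube-complete s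
  ... | s' , s'∈ , s'≗s =
    trans (cong isNonNeg (⟦⟧-cong φ (sym ∘ s'≗s)))
      (maximal-correlation⇒⊆threshold _ ⟦ φ ⟧ (threshold ⟦ ψ ⟧)
        (sym (same-chow⇒same-correlation _ _ φ≗ψ φ)) s'∈
        (trans (cong isNonNeg (⟦⟧-cong ψ s'≗s)) ψs))

  chow-theorem : ∀ {k} (φ ψ : LinearForm k) → chow (threshold ⟦ φ ⟧) ≗ chow (threshold ⟦ ψ ⟧) →
                 ∀ s → threshold ⟦ φ ⟧ s ≡ threshold ⟦ ψ ⟧ s
  chow-theorem φ ψ φ≗ψ s = Boolₚ.⇔→≡ (mk⇔ (chow-⊆ ψ φ (sym ∘ φ≗ψ) s) (chow-⊆ φ ψ φ≗ψ s))

module Cuts where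
  private variable
    k n n' : ℕ

  open import Data.Rational using (ℚ; 0ℚ; _+_; _*_; _≤_)
  import Data.Rational.Properties as ℚₚ
  open import Relation.Nullary.Decidable using (_×-dec_; _⊎-dec_)
  open Sums
  open ChowTheorem using (sign)
  open RationalLemmas using (c≡0+c*1; 0≡c+c*-1)

  Labelling : ℕ → Set
  Labelling n = Fin n → Bool

  cutEdge : Labelling n → Edge n → ℚ
  cutEdge σ e = if σ (src e) xor σ (tgt e) then cap e else 0ℚ

  cut : Graph n → Labelling n → ℚ
  cut G σ = ∑ G (cutEdge σ)

  crossing : (G : Graph n) → Labelling n → EdgeSet G
  crossing G σ i = σ (src (lookup G i)) xor σ (tgt (lookup G i))

  weight-crossing : ∀ (G : Graph n) σ → weight G (crossing G σ) ≡ cut G σ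
  weight-crossing []      σ = refl
  weight-crossing (e ∷ G) σ with σ (src e) xor σ (tgt e)
  ... | true  = cong (cap e +_) (weight-crossing G σ)
  ... | false = trans (weight-crossing G σ) (sym (ℚₚ.+-identityˡ _))

  cut-cong : ∀ (G : Graph n) {σ σ'} → σ ≗ σ' → cut G σ ≡ cut G σ'
  cut-cong G {σ} {σ'} eq = ∑-cong G λ e → cong₂ (λ a b → if a xor b then cap e else 0ℚ) (eq (src e)) (eq (tgt e))

  weight-mono : ∀ (G : Graph n) → PositiveWeights G → ∀ {C D : EdgeSet G} →
                (∀ i → C i ≡ true → D i ≡ true) → weight G C ≤ weight G D
  weight-mono []      _        C⊆D = ℚₚ.≤-refl
  weight-mono (e ∷ G) (0<e ∷ pw) {C} {D} C⊆D with C zero in C₀ | D zero in D₀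
  ... | true  | true  = ℚₚ.+-monoʳ-≤ (cap e) (weight-mono G pw (C⊆D ∘ suc))
  ... | true  | false = contradiction (trans (sym (C⊆D zero C₀)) D₀) λ ()
  ... | false | true  = ℚₚ.≤-trans (ℚₚ.≤-reflexive (sym (ℚₚ.+-identityˡ _)))
                          (ℚₚ.+-mono-≤ (ℚₚ.<⇒≤ 0<e) (weight-mono G pw (C⊆D ∘ suc)))
  ... | false | false = weight-mono G pw (C⊆D ∘ suc)

  Extends : (Fin k → Fin n) → (Fin k → Bool) → Labelling n → Set
  Extends term s σ = ∀ i → σ (term i) ≡ s i

  joins-sym : ∀ {e : Edge n} {x y} → Joins e x y → Joins e y x
  joins-sym (inj₁ (p , q)) = inj₂ (p , q)
  joins-sym (inj₂ (p , q)) = inj₁ (p , q)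

  joins? : ∀ (e : Edge n) x y → Dec (Joins e x y)
  joins? e x y = ((src e ≟ x) ×-dec (tgt e ≟ y)) ⊎-dec ((src e ≟ y) ×-dec (tgt e ≟ x))

  joins-same-label : ∀ (σ : Labelling n) e {x y} → σ (src e) ≡ σ (tgt e) → Joins e x y → σ x ≡ σ y
  joins-same-label σ e eq (inj₁ (refl , refl)) = eq
  joins-same-label σ e eq (inj₂ (refl , refl)) = sym eq

  reach-preserves-label : ∀ (G : Graph n) σ {u w} → Reach G (crossing G σ) u w → σ u ≡ σ w
  reach-preserves-label G σ here                = refl
  reach-preserves-label G σ (step i uncut J r) =
    trans (reach-preserves-label G σ r) (joins-same-label σ (lookup G i) (xor-false uncut) J)
    where xor-false : ∀ {a b} → a xor b ≡ false → a ≡ b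
          xor-false {false} {false} _ = refl
          xor-false {true}  {true}  _ = refl

  crossing-disconnects : ∀ (G : Graph n) {term : Fin k → Fin n} {s} σ →
                         Extends term s σ → Disconnects G term s (crossing G σ)
  crossing-disconnects G {term} {s} σ ext i j sᵢ sⱼ r = contradiction label-eq λ ()
    where label-eq : true ≡ false
          label-eq = begin
            true        ≡⟨ sym sᵢ ⟩
            s i         ≡⟨ sym (ext i) ⟩
            σ (term i)  ≡⟨ reach-preserves-label G σ r ⟩
            σ (term j)  ≡⟨ ext j ⟩
            s j         ≡⟨ sⱼ ⟩
            false       ∎
            where open ≡-Reasoning

  cut-contract : ∀ (f : Fin n → Fin n') G τ → cut (contract f G) τ ≡ cut G (τ ∘ f)
  cut-contract f []      τ = refl
  cut-contract f (e ∷ G) τ with f (src e) ≟ f (tgt e)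
  ... | no _       = cong (cutEdge (τ ∘ f) e +_) (cut-contract f G τ)
  ... | yes fe≡fe' = begin
    cut (contract f G) τ                            ≡⟨ cut-contract f G τ ⟩
    cut G (τ ∘ f)                                   ≡⟨ sym (ℚₚ.+-identityˡ _) ⟩
    0ℚ + cut G (τ ∘ f)                              ≡⟨ cong (λ b → (if b then cap e else 0ℚ) + cut G (τ ∘ f)) (sym loop) ⟩
    cutEdge (τ ∘ f) e + cut G (τ ∘ f)               ∎
    where open ≡-Reasoning
          loop : τ (f (src e)) xor τ (f (tgt e)) ≡ false
          loop = trans (cong (λ x → τ x xor τ (f (tgt e))) fe≡fe') (Boolₚ.xor-same (τ (f (tgt e))))

  contract-positive : ∀ (f : Fin n → Fin n') G → PositiveWeights G → PositiveWeights (contract f G)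
  contract-positive f []      []         = []
  contract-positive f (e ∷ G) (0<e ∷ pw) with f (src e) ≟ f (tgt e)
  ... | yes _ = contract-positive f G pw
  ... | no _  = 0<e ∷ contract-positive f G pw

  contract-quasiBipartite : ∀ (f : Fin n → Fin n') G {term : Fin k → Fin n} →
                            QuasiBipartite G term → QuasiBipartite (contract f G) (f ∘ term)
  contract-quasiBipartite f []      []       = []
  contract-quasiBipartite f (e ∷ G) {term} (q ∷ qb) with f (src e) ≟ f (tgt e)
  ... | yes _ = contract-quasiBipartite f G qb
  ... | no _  = image q ∷ contract-quasiBipartite f G qb
    where image : ∀ {x y} → IsTerminal term x ⊎ IsTerminal term y →
                  IsTerminal (f ∘ term) (f x) ⊎ IsTerminal (f ∘ term) (f y)
          image (inj₁ (i , eq)) = inj₁ (i , cong f eq)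
          image (inj₂ (i , eq)) = inj₂ (i , cong f eq)

  _[_≔_] : Labelling n → Fin n → Bool → Labelling n
  (σ [ v ≔ b ]) w = if does (w ≟ v) then b else σ w

  update-same : ∀ (σ : Labelling n) v → σ [ v ≔ σ v ] ≗ σ
  update-same σ v w with w ≟ v
  ... | yes refl = refl
  ... | no  _    = refl

  incident : Edge n → Fin n → Bool
  incident e v = does (src e ≟ v) ∨ does (tgt e ≟ v)

  other : Edge n → Fin n → Fin n
  other e v = if does (src e ≟ v) then tgt e else src e

  gainEdge : Labelling n → Fin n → Edge n → ℚ
  gainEdge σ v e = if incident e v then cap e * sign (σ (other e v)) else 0ℚ

  gain : Graph n → Labelling n → Fin n → ℚ
  gain G σ v = ∑ G (gainEdge σ v)

  gainEdge-src : ∀ (σ : Labelling n) {v} e → src e ≡ v → gainEdge σ v e ≡ cap e * sign (σ (tgt e))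
  gainEdge-src σ {v} e src≡v with src e ≟ v
  ... | yes _      = refl
  ... | no  src≢v  = contradiction src≡v src≢v

  gainEdge-nonincident : ∀ (σ : Labelling n) {v} e → src e ≢ v → tgt e ≢ v → gainEdge σ v e ≡ 0ℚ
  gainEdge-nonincident σ {v} e src≢v tgt≢v with src e ≟ v | tgt e ≟ v
  ... | yes src≡v | _         = contradiction src≡v src≢v
  ... | no  _     | yes tgt≡v = contradiction tgt≡v tgt≢v
  ... | no  _     | no  _     = refl

  cutEdge-flip : ∀ (σ : Labelling n) {v} e → ¬ (src e ≡ v × tgt e ≡ v) →
                 cutEdge (σ [ v ≔ false ]) e ≡ cutEdge (σ [ v ≔ true ]) e + gainEdge σ v e
  cutEdge-flip σ {v} e not-loop with src e ≟ v | tgt e ≟ v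
  ... | yes p | yes q = contradiction (p , q) not-loop
  ... | yes _ | no _  = flip (σ (tgt e))
    where flip : ∀ b → (if b then cap e else 0ℚ) ≡ (if not b then cap e else 0ℚ) + cap e * sign b
          flip true  = c≡0+c*1 (cap e)
          flip false = 0≡c+c*-1 (cap e)
  ... | no _  | yes _ = flip (σ (src e))
    where flip : ∀ b → (if b xor false then cap e else 0ℚ) ≡ (if b xor true then cap e else 0ℚ) + cap e * sign b
          flip true  = c≡0+c*1 (cap e)
          flip false = 0≡c+c*-1 (cap e)
  ... | no _  | no _  = sym (ℚₚ.+-identityʳ _)

module Terminals {n k} (term : Fin k → Fin n) where
  open import Data.Rational using (_+_; _*_)
  import Data.Rational.Properties as ℚₚ
  open Sums
  open ChowTheorem using (sign; LinearForm; ⟦_⟧)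
  open Cuts

  isTerminal? : ∀ w → Dec (IsTerminal term w)
  isTerminal? w = Finₚ.any? (λ i → term i ≟ w)

  module _ {v : Fin n} (v∉T : ¬ IsTerminal term v) {e : Edge n} where

    not-loop : IsTerminal term (src e) ⊎ IsTerminal term (tgt e) → ¬ (src e ≡ v × tgt e ≡ v)
    not-loop (inj₁ (i , tᵢ≡src)) (src≡v , _) = v∉T (i , trans tᵢ≡src src≡v)
    not-loop (inj₂ (i , tᵢ≡tgt)) (_ , tgt≡v) = v∉T (i , trans tᵢ≡tgt tgt≡v)

    other-terminal : IsTerminal term (src e) ⊎ IsTerminal term (tgt e) →
                     incident e v ≡ true → IsTerminal term (other e v)
    other-terminal q inc with src e ≟ v | tgt e ≟ v | q
    ... | yes src≡v | _         | inj₁ (i , tᵢ≡src) = contradiction (i , trans tᵢ≡src src≡v) v∉T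
    ... | yes _     | _         | inj₂ t            = t
    ... | no  _     | yes _     | inj₁ t            = t
    ... | no  _     | yes tgt≡v | inj₂ (i , tᵢ≡tgt) = contradiction (i , trans tᵢ≡tgt tgt≡v) v∉T

  linearForm : Graph n → Fin n → LinearForm k
  linearForm []      v = []
  linearForm (e ∷ G) v with incident e v | isTerminal? (other e v)
  ... | true | yes (i , _) = (cap e , i) ∷ linearForm G v
  ... | _    | _           = linearForm G v

  gain-linear : ∀ G → QuasiBipartite G term → ∀ σ {v} → ¬ IsTerminal term v →
                gain G σ v ≡ ⟦ linearForm G v ⟧ (σ ∘ term)
  gain-linear []      []       σ v∉T = refl
  gain-linear (e ∷ G) (q ∷ qb) σ {v} v∉T with incident e v in inc | isTerminal? (other e v)
  ... | true  | yes (i , tᵢ≡) = cong₂ _+_ (cong (λ w → cap e * sign (σ w)) (sym tᵢ≡)) (gain-linear G qb σ v∉T)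
  ... | true  | no  w∉T       = contradiction (other-terminal v∉T {e} q inc) w∉T
  ... | false | _             = trans (ℚₚ.+-identityˡ _) (gain-linear G qb σ v∉T)

  cut-flip : ∀ G → QuasiBipartite G term → ∀ σ {v} → ¬ IsTerminal term v →
             cut G (σ [ v ≔ false ]) ≡ cut G (σ [ v ≔ true ]) + gain G σ v
  cut-flip G qb σ v∉T = trans (∑-cong-All (All.map (λ {e} q → cutEdge-flip σ e (not-loop v∉T {e} q)) qb)) (∑-+ G)

module QuasiBipartiteCuts {n k} (G : Graph n) (term : Fin k → Fin n)
               (term-injective : Injective _≡_ _≡_ term) (qb : QuasiBipartite G term) where
  open import Data.Rational using (0ℚ; _+_; _≤_; _<_; _≤?_)
  open import Data.Rational.Properties using (≤-refl; ≤-trans; ≤-reflexive; <⇒≤; ≰⇒>; <-irrefl; module ≤-Reasoning)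
  open import Data.List.Membership.Propositional.Properties using (∈-allFin)
  open import Relation.Nullary.Decidable using (_×-dec_)
  open RationalLemmas
  open ChowTheorem
  open Cuts
  open Terminals term

  MinimalExtension : (Fin k → Bool) → Labelling n → Set
  MinimalExtension s σ = Extends term s σ × (∀ σ' → Extends term s σ' → cut G σ ≤ cut G σ')

  extendBy : (Fin k → Bool) → Labelling n → Labelling n
  extendBy s τ w with isTerminal? w
  ... | yes (i , _) = s i
  ... | no  _       = τ w

  extendBy-extends : ∀ s τ → Extends term s (extendBy s τ)
  extendBy-extends s τ i with isTerminal? (term i)
  ... | yes (i' , tᵢ'≡tᵢ) = cong s (term-injective tᵢ'≡tᵢ)
  ... | no  tᵢ∉T          = contradiction (i , refl) tᵢ∉T

  -- A non-terminal goes to side true iff a kept edge joins it to a true terminal; since every edge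
  -- has a terminal end and F separates the sides, no kept edge is then cut.
  module CutToLabelling (s : Fin k → Bool) (F : EdgeSet G) (F-disconnects : Disconnects G term s F) where

    KeptEdgeFromT₁ : Fin n → Fin (length G) → Set
    KeptEdgeFromT₁ w idx = F idx ≡ false × ∃ λ i → s i ≡ true × Joins (lookup G idx) (term i) w

    keptEdgeFromT₁? : ∀ w idx → Dec (KeptEdgeFromT₁ w idx)
    keptEdgeFromT₁? w idx = (F idx Boolₚ.≟ false)
      ×-dec Finₚ.any? (λ i → (s i Boolₚ.≟ true) ×-dec joins? (lookup G idx) (term i) w)

    σF : Labelling n
    σF = extendBy s (λ w → does (Finₚ.any? (keptEdgeFromT₁? w)))

    kept-edge-agrees : ∀ idx i {y} → F idx ≡ false → Joins (lookup G idx) (term i) y → s i ≡ σF y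
    kept-edge-agrees idx i {y} kept J with isTerminal? y
    kept-edge-agrees idx i kept J | yes (j , refl) with s i in sᵢ | s j in sⱼ
    ... | true  | true  = refl
    ... | false | false = refl
    ... | true  | false = contradiction (step idx kept J here) (F-disconnects i j sᵢ sⱼ)
    ... | false | true  = contradiction (step idx kept (joins-sym {e = lookup G idx} J) here) (F-disconnects j i sⱼ sᵢ)
    kept-edge-agrees idx i {y} kept J | no _ with Finₚ.any? (keptEdgeFromT₁? y) | s i in sᵢ
    ... | yes _    | true  = refl
    ... | no  none | true  = contradiction (idx , kept , i , sᵢ , J) none
    ... | no  _    | false = refl
    ... | yes (idx' , kept' , i' , sᵢ' , J') | false =
      contradiction (step idx kept (joins-sym {e = lookup G idx} J) (step idx' kept' J' here)) (F-disconnects i' i sᵢ' sᵢ)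

    kept-edge-uncut : ∀ idx → F idx ≡ false → σF (src (lookup G idx)) ≡ σF (tgt (lookup G idx))
    kept-edge-uncut idx kept with All.lookup qb (∈-lookup idx)
    ... | inj₁ (i , tᵢ≡src) = begin
      σF (src (lookup G idx)) ≡⟨ cong σF tᵢ≡src ⟨
      σF (term i)             ≡⟨ extendBy-extends s _ i ⟩
      s i                     ≡⟨ kept-edge-agrees idx i kept (inj₁ (sym tᵢ≡src , refl)) ⟩
      σF (tgt (lookup G idx)) ∎
      where open ≡-Reasoning
    ... | inj₂ (i , tᵢ≡tgt) = begin
      σF (src (lookup G idx)) ≡⟨ kept-edge-agrees idx i kept (inj₂ (refl , sym tᵢ≡tgt)) ⟨
      s i                     ≡⟨ extendBy-extends s _ i ⟨
      σF (term i)             ≡⟨ cong σF tᵢ≡tgt ⟩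
      σF (tgt (lookup G idx)) ∎
      where open ≡-Reasoning

    crossing⊆F : ∀ idx → crossing G σF idx ≡ true → F idx ≡ true
    crossing⊆F idx crosses with F idx in F-idx
    ... | true  = refl
    ... | false = contradiction (trans (sym crosses) uncut) λ ()
      where uncut : crossing G σF idx ≡ false
            uncut = trans (cong (_xor σF (tgt (lookup G idx))) (kept-edge-uncut idx F-idx))
                          (Boolₚ.xor-same (σF (tgt (lookup G idx))))

  disconnecting⇒labelling : PositiveWeights G → ∀ s F → Disconnects G term s F →
                            ∃ λ σ → Extends term s σ × cut G σ ≤ weight G F
  disconnecting⇒labelling pw s F F-disconnects = σF , extendBy-extends s _ , (begin
    cut G σF                 ≡⟨ weight-crossing G σF ⟨
    weight G (crossing G σF) ≤⟨ weight-mono G pw crossing⊆F ⟩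
    weight G F               ∎)
    where open CutToLabelling s F F-disconnects
          open ≤-Reasoning

  minimal-isMinCut : PositiveWeights G → ∀ {s σ} → MinimalExtension s σ → IsMinCut G term s (cut G σ)
  minimal-isMinCut pw {s} {σ} (σ-extends , σ-minimal) =
    (crossing G σ , crossing-disconnects G σ σ-extends , weight-crossing G σ) ,
    λ F F-disconnects → let σ' , σ'-extends , cut≤F = disconnecting⇒labelling pw s F F-disconnects
                        in ≤-trans (σ-minimal σ' σ'-extends) cut≤F

  update-extends : ∀ {s} σ v b → Extends term s σ → (∀ i → term i ≡ v → b ≡ s i) →
                   Extends term s (σ [ v ≔ b ])
  update-extends σ v b σ-extends agrees i with term i ≟ v
  ... | yes tᵢ≡v = agrees i tᵢ≡v
  ... | no  _    = σ-extends i

  cut-update-same : ∀ σ {v b} → σ v ≡ b → cut G (σ [ v ≔ b ]) ≡ cut G σ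
  cut-update-same σ {v} refl = cut-cong G (update-same σ v)

  best-update : ∀ σ {v} → ¬ IsTerminal term v → ∀ b →
                cut G (σ [ v ≔ threshold (gain G σ) v ]) ≤ cut G (σ [ v ≔ b ])
  best-update σ {v} v∉T = best (0ℚ ≤? gain G σ v)
    where
    open ≤-Reasoning
    flip : cut G (σ [ v ≔ false ]) ≡ cut G (σ [ v ≔ true ]) + gain G σ v
    flip = cut-flip G qb σ v∉T
    best : (d : Dec (0ℚ ≤ gain G σ v)) → ∀ b → cut G (σ [ v ≔ does d ]) ≤ cut G (σ [ v ≔ b ])
    best (yes _)   true  = ≤-refl
    best (no  _)   false = ≤-refl
    best (yes 0≤g) false = begin
      cut G (σ [ v ≔ true ])                 ≤⟨ x≤x+y _ 0≤g ⟩
      cut G (σ [ v ≔ true ]) + gain G σ v    ≡⟨ flip ⟨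
      cut G (σ [ v ≔ false ])                ∎
    best (no  0≰g) true  = begin
      cut G (σ [ v ≔ false ])                ≡⟨ flip ⟩
      cut G (σ [ v ≔ true ]) + gain G σ v    ≤⟨ x+y≤x _ (<⇒≤ (≰⇒> 0≰g)) ⟩
      cut G (σ [ v ≔ true ])                 ∎

  minimal-sign : ∀ {s σ} → MinimalExtension s σ → ∀ {v} → ¬ IsTerminal term v →
                 (gain G σ v < 0ℚ → σ v ≡ false) × (0ℚ < gain G σ v → σ v ≡ true)
  minimal-sign {s} {σ} (σ-extends , σ-minimal) {v} v∉T = negative , positive
    where
    open ≤-Reasoning
    flip : cut G (σ [ v ≔ false ]) ≡ cut G (σ [ v ≔ true ]) + gain G σ v
    flip = cut-flip G qb σ v∉T
    no-improvement : ∀ b → cut G σ ≤ cut G (σ [ v ≔ b ])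
    no-improvement b = σ-minimal (σ [ v ≔ b ]) (update-extends σ v b σ-extends λ i tᵢ≡v → contradiction (i , tᵢ≡v) v∉T)
    negative : gain G σ v < 0ℚ → σ v ≡ false
    negative g<0 with σ v in σv
    ... | false = refl
    ... | true  = contradiction (begin-strict
      cut G (σ [ v ≔ false ])               ≡⟨ flip ⟩
      cut G (σ [ v ≔ true ]) + gain G σ v   <⟨ x+y<x _ g<0 ⟩
      cut G (σ [ v ≔ true ])                ≡⟨ cut-update-same σ σv ⟩
      cut G σ                               ≤⟨ no-improvement false ⟩
      cut G (σ [ v ≔ false ])               ∎) (<-irrefl refl)
    positive : 0ℚ < gain G σ v → σ v ≡ true
    positive 0<g with σ v in σv
    ... | true  = refl
    ... | false = contradiction (begin-strict
      cut G (σ [ v ≔ true ])                <⟨ x<x+y _ 0<g ⟩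
      cut G (σ [ v ≔ true ]) + gain G σ v   ≡⟨ flip ⟨
      cut G (σ [ v ≔ false ])               ≡⟨ cut-update-same σ σv ⟩
      cut G σ                               ≤⟨ no-improvement true ⟩
      cut G (σ [ v ≔ true ])                ∎) (<-irrefl refl)

  optimal : (Fin k → Bool) → Labelling n
  optimal s = extendBy s (λ w → threshold ⟦ linearForm G w ⟧ s)

  update-optimal : ∀ {s σ} → Extends term s σ → ∀ v → cut G (σ [ v ≔ optimal s v ]) ≤ cut G σ
  update-optimal {s} {σ} σ-extends v with isTerminal? v
  ... | yes (i , tᵢ≡v) = ≤-reflexive (cut-update-same σ (trans (cong σ (sym tᵢ≡v)) (σ-extends i)))
  ... | no  v∉T        = begin
    cut G (σ [ v ≔ threshold ⟦ linearForm G v ⟧ s ]) ≡⟨ cong (λ b → cut G (σ [ v ≔ b ])) same-threshold ⟨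
    cut G (σ [ v ≔ threshold (gain G σ) v ])         ≤⟨ best-update σ v∉T (σ v) ⟩
    cut G (σ [ v ≔ σ v ])                            ≡⟨ cut-update-same σ refl ⟩
    cut G σ                                          ∎
    where
    open ≤-Reasoning
    same-threshold : threshold (gain G σ) v ≡ threshold ⟦ linearForm G v ⟧ s
    same-threshold = cong isNonNeg (trans (gain-linear G qb σ v∉T) (⟦⟧-cong (linearForm G v) σ-extends))

  sweep : (Fin k → Bool) → Labelling n → List (Fin n) → Labelling n
  sweep s σ []       = σ
  sweep s σ (v ∷ vs) = sweep s σ vs [ v ≔ optimal s v ]

  module _ {s σ} (σ-extends : Extends term s σ) where

    sweep-extends : ∀ vs → Extends term s (sweep s σ vs)
    sweep-extends []       = σ-extends
    sweep-extends (v ∷ vs) = update-extends (sweep s σ vs) v (optimal s v) (sweep-extends vs)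
      λ i tᵢ≡v → trans (cong (optimal s) (sym tᵢ≡v)) (extendBy-extends s _ i)

    sweep-≤ : ∀ vs → cut G (sweep s σ vs) ≤ cut G σ
    sweep-≤ []       = ≤-refl
    sweep-≤ (v ∷ vs) = ≤-trans (update-optimal (sweep-extends vs) v) (sweep-≤ vs)

  sweep-optimal : ∀ s σ vs {w} → w ∈ vs → sweep s σ vs w ≡ optimal s w
  sweep-optimal s σ (v ∷ vs) {w} w∈ with w ≟ v | w∈
  ... | yes refl | _          = refl
  ... | no  w≢v  | here w≡v   = contradiction w≡v w≢v
  ... | no  _    | there w∈vs = sweep-optimal s σ vs w∈vs

  optimal-minimal : ∀ s → MinimalExtension s (optimal s)
  optimal-minimal s = extendBy-extends s _ , λ σ σ-extends → begin
    cut G (optimal s)              ≡⟨ cut-cong G (λ w → sweep-optimal s σ (allFin n) (∈-allFin w)) ⟨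
    cut G (sweep s σ (allFin n))   ≤⟨ sweep-≤ σ-extends (allFin n) ⟩
    cut G σ                        ∎
    where open ≤-Reasoning

module Contraction {n n' k} (G : Graph n) (term : Fin k → Fin n) (term-injective : Injective _≡_ _≡_ term)
                   (qb : QuasiBipartite G term) (pw : PositiveWeights G)
                   (f : Fin n → Fin n') (partition : IsTerminalSeparatingPartition term f) where
  open import Data.Rational using (_≤_)
  open import Data.Rational.Properties using (module ≤-Reasoning)
  open Cuts
  open QuasiBipartiteCuts G term term-injective qb using (MinimalExtension)
  private
    H = contract f G
    module H = QuasiBipartiteCuts H (f ∘ term) (proj₂ partition) (contract-quasiBipartite f G qb)

  ConstantOnFibres : Labelling n → Set
  ConstantOnFibres σ = ∀ {x y} → f x ≡ f y → σ x ≡ σ y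

  minimal-isMinCut-contract : ∀ {s σ} → MinimalExtension s σ → ConstantOnFibres σ →
                              IsMinCut H (f ∘ term) s (cut G σ)
  minimal-isMinCut-contract {s} {σ} (σ-extends , σ-minimal) σ-constant =
    (crossing H τ , crossing-disconnects H τ τ-extends , cutH≡cutG) ,
    λ F F-disconnects →
      let τ' , τ'-extends , cut≤F = H.disconnecting⇒labelling (contract-positive f G pw) s F F-disconnects
      in begin
        cut G σ        ≤⟨ σ-minimal (τ' ∘ f) τ'-extends ⟩
        cut G (τ' ∘ f) ≡⟨ cut-contract f G τ' ⟨
        cut H τ'       ≤⟨ cut≤F ⟩
        weight H F     ∎
    where
    open ≤-Reasoning
    τ : Labelling n'
    τ y = σ (proj₁ (proj₁ partition y))
    τ∘f≗σ : τ ∘ f ≗ σ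
    τ∘f≗σ x = σ-constant (proj₂ (proj₁ partition (f x)))
    τ-extends : Extends (f ∘ term) s τ
    τ-extends i = trans (τ∘f≗σ (term i)) (σ-extends i)
    cutH≡cutG : weight H (crossing H τ) ≡ cut G σ
    cutH≡cutG = trans (weight-crossing H τ) (trans (cut-contract f G τ) (cut-cong G τ∘f≗σ))

  exact⇒minimal-constant : ExactCutSparsifier G term H (f ∘ term) → ∀ s → NontrivialSide s →
                           ∃ λ σ → MinimalExtension s σ × ConstantOnFibres σ
  exact⇒minimal-constant exact s nontrivial
    with exact s nontrivial
  ... | c , (_ , c≤G) , ((F , F-disconnects , F≡c) , _)
    with H.disconnecting⇒labelling (contract-positive f G pw) s F F-disconnects
  ... | τ , τ-extends , τ≤F = τ ∘ f , (τ-extends , minimal) , cong τ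
    where
    open ≤-Reasoning
    minimal : ∀ σ' → Extends term s σ' → cut G (τ ∘ f) ≤ cut G σ'
    minimal σ' σ'-extends = begin
      cut G (τ ∘ f)            ≡⟨ cut-contract f G τ ⟨
      cut H τ                  ≤⟨ τ≤F ⟩
      weight H F               ≡⟨ F≡c ⟩
      c                        ≤⟨ c≤G (crossing G σ') (crossing-disconnects G σ' σ'-extends) ⟩
      weight G (crossing G σ') ≡⟨ weight-crossing G σ' ⟩
      cut G σ'                 ∎

module UpperBound {n k} (G : Graph n) (term : Fin k → Fin n)
                  (term-injective : Injective _≡_ _≡_ term) (qb : QuasiBipartite G term) where
  open ChowTheorem
  open Cuts
  open Terminals term
  open QuasiBipartiteCuts G term term-injective qb

  classCount : ℕ
  classCount = k ℕ.+ suc (length (cube k)) ℕ.^ suc k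

  chowCode : ((Fin k → Bool) → Bool) → Fin (suc k) → Fin (suc (length (cube k)))
  chowCode p j = Fin.fromℕ< (ℕ.s≤s (chow≤length p j))

  chowCode-injective : ∀ p q → Fin.funToFin (chowCode p) ≡ Fin.funToFin (chowCode q) → chow p ≗ chow q
  chowCode-injective p q eq j = begin
    chow p j                                 ≡⟨ Finₚ.toℕ-fromℕ< _ ⟨
    Fin.toℕ (chowCode p j)                   ≡⟨ cong Fin.toℕ (Finₚ.finToFun-funToFin (chowCode p) j) ⟨
    Fin.toℕ (Fin.finToFun (Fin.funToFin (chowCode p)) j) ≡⟨ cong (λ c → Fin.toℕ (Fin.finToFun c j)) eq ⟩
    Fin.toℕ (Fin.finToFun (Fin.funToFin (chowCode q)) j) ≡⟨ cong Fin.toℕ (Finₚ.finToFun-funToFin (chowCode q) j) ⟩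
    Fin.toℕ (chowCode q j)                   ≡⟨ Finₚ.toℕ-fromℕ< _ ⟩
    chow q j                                 ∎
    where open ≡-Reasoning

  classOf : Fin n → Fin classCount
  classOf w with isTerminal? w
  ... | yes (i , _) = i ↑ˡ _
  ... | no  _       = k ↑ʳ Fin.funToFin (chowCode (threshold ⟦ linearForm G w ⟧))

  classOf-terminal : ∀ i → classOf (term i) ≡ i ↑ˡ _
  classOf-terminal i with isTerminal? (term i)
  ... | yes (i' , tᵢ'≡tᵢ) = cong (_↑ˡ _) (term-injective tᵢ'≡tᵢ)
  ... | no  tᵢ∉T          = contradiction (i , refl) tᵢ∉T

  optimal-respects-class : ∀ s {x y} → classOf x ≡ classOf y → optimal s x ≡ optimal s y
  optimal-respects-class s {x} {y} eq with isTerminal? x | isTerminal? y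
  ... | yes (i , _) | yes (j , _) = cong s (Finₚ.↑ˡ-injective _ i j eq)
  ... | yes (i , _) | no  _       = contradiction eq (↑ˡ≢↑ʳ i _)
  ... | no  _       | yes (j , _) = contradiction (sym eq) (↑ˡ≢↑ʳ j _)
  ... | no  _       | no  _       =
    chow-theorem (linearForm G x) (linearForm G y) (chowCode-injective _ _ (Finₚ.↑ʳ-injective k _ _ eq)) s

  sparsifier : PositiveWeights G →
    ∃ λ n' → Σ (Fin n → Fin n') λ f →
      IsTerminalSeparatingPartition term f × ExactCutSparsifier G term (contract f G) (f ∘ term) × n' ℕ.≤ classCount
  sparsifier pw = size , surjection , partition , exact , Finₚ.injective⇒≤ injective
    where
    open ImageFactorisation (factorise classOf)
    same-class : ∀ {x y} → surjection x ≡ surjection y → classOf x ≡ classOf y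
    same-class {x} {y} eq = trans (sym (factors x)) (trans (cong injection eq) (factors y))
    partition : IsTerminalSeparatingPartition term surjection
    partition = surjective , λ {i} {j} eq →
      Finₚ.↑ˡ-injective _ i j (trans (sym (classOf-terminal i)) (trans (same-class eq) (classOf-terminal j)))
    open Contraction G term term-injective qb pw surjection partition
    exact : ExactCutSparsifier G term (contract surjection G) (surjection ∘ term)
    exact s _ = cut G (optimal s) ,
      minimal-isMinCut pw {s} {optimal s} (optimal-minimal s) ,
      minimal-isMinCut-contract {s} {optimal s} (optimal-minimal s) (optimal-respects-class s ∘ same-class)

module LowerBound (m : ℕ) where
  open import Data.Rational using (ℚ; 0ℚ; 1ℚ; _+_; _≤_; _<_; _≤?_; _<?_)
  open import Data.Rational.Properties
    using (≤-refl; ≤-trans; ≤-<-trans; <-≤-trans; +-monoʳ-≤; *-identityˡ; positive⁻¹)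
  open import Data.List.Membership.Propositional.Properties using (∈-allFin)
  open import Data.List.Relation.Unary.All.Properties using (concat⁺; map⁺)
  open import Relation.Nullary.Decidable using (True; toWitness; dec-true; dec-false)
  open Sums
  open ChowTheorem using (sign)
  open Cuts

  k N n : ℕ
  k = 3 ℕ.+ m
  N = 2 ℕ.^ m
  n = k ℕ.+ N

  terminal : Fin k → Fin n
  terminal t = t ↑ˡ N

  hub : Fin N → Fin n
  hub j = k ↑ʳ j

  A B E : Fin k
  A = zero
  B = suc zero
  E = suc (suc zero)

  T : Fin m → Fin k
  T i = suc (suc (suc i))

  bit : Fin N → Fin m → Fin 2
  bit = Fin.finToFun

  pairFor : Fin 2 → Fin m → List (Fin k)
  pairFor zero    i = []
  pairFor (suc _) i = A ∷ T i ∷ []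

  neighbours : Fin N → List (Fin k)
  neighbours j = E ∷ A ∷ B ∷ concatMap (λ i → pairFor (bit j i) i) (allFin m)

  spoke : Fin N → Fin k → Edge n
  spoke j t = edge (hub j) (terminal t) 1ℚ

  star : Fin N → Graph n
  star j = map (spoke j) (neighbours j)

  graph : Graph n
  graph = concatMap star (allFin N)

  every-edge : ∀ {P : Edge n → Set} → (∀ j t → P (spoke j t)) → All P graph
  every-edge p = concat⁺ (map⁺ (All.universal (λ j → map⁺ (All.universal (p j) (neighbours j))) (allFin N)))

  positive : PositiveWeights graph
  positive = every-edge λ _ _ → positive⁻¹ 1ℚ

  quasiBipartite : QuasiBipartite graph terminal
  quasiBipartite = every-edge λ _ t → inj₂ (t , refl)

  terminal-injective : Injective _≡_ _≡_ terminal
  terminal-injective = Finₚ.↑ˡ-injective N _ _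

  hub∉T : ∀ j → ¬ IsTerminal terminal (hub j)
  hub∉T j (t , eq) = ↑ˡ≢↑ʳ t j eq

  pairGain : (Fin k → Bool) → Fin 2 → Fin m → ℚ
  pairGain s b i = ∑ (pairFor b i) (sign ∘ s)

  hubGain : (Fin k → Bool) → Fin N → ℚ
  hubGain s j = ∑ (neighbours j) (sign ∘ s)

  gain-hub : ∀ {s σ} → Extends terminal s σ → ∀ j → gain graph σ (hub j) ≡ hubGain s j
  gain-hub {s} {σ} σ-extends j = begin
    gain graph σ (hub j)                           ≡⟨ ∑-concatMap star (allFin N) (gainEdge σ (hub j)) ⟩
    ∑ (allFin N) (λ j' → gain (star j') σ (hub j)) ≡⟨ ∑-allFin-δ N (λ j' → gain (star j') σ (hub j)) j elsewhere ⟩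
    gain (star j) σ (hub j)                        ≡⟨ ∑-map (spoke j) (neighbours j) (gainEdge σ (hub j)) ⟩
    ∑ (neighbours j) (gainEdge σ (hub j) ∘ spoke j) ≡⟨ ∑-cong (neighbours j) centre ⟩
    hubGain s j                                    ∎
    where
    open ≡-Reasoning
    centre : ∀ t → gainEdge σ (hub j) (spoke j t) ≡ sign (s t)
    centre t = trans (gainEdge-src σ (spoke j t) refl) (trans (*-identityˡ _) (cong sign (σ-extends t)))
    elsewhere : ∀ j' → j' ≢ j → gain (star j') σ (hub j) ≡ 0ℚ
    elsewhere j' j'≢j = trans (∑-map (spoke j') (neighbours j') (gainEdge σ (hub j))) (∑-zero (neighbours j') λ t →
      gainEdge-nonincident σ (spoke j' t) (j'≢j ∘ Finₚ.↑ʳ-injective k _ _) (↑ˡ≢↑ʳ t j))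

  private
    ≤-by-evaluation : ∀ {p q} → True (p ≤? q) → p ≤ q
    ≤-by-evaluation = toWitness
    <-by-evaluation : ∀ {p q} → True (p <? q) → p < q
    <-by-evaluation = toWitness
    +-monoʳ-≤³ : ∀ a b c {P Q} → P ≤ Q → a + (b + (c + P)) ≤ a + (b + (c + Q))
    +-monoʳ-≤³ a b c P≤Q = +-monoʳ-≤ a (+-monoʳ-≤ b (+-monoʳ-≤ c P≤Q))

  hubGain-split : ∀ s j → hubGain s j ≡
    sign (s E) + (sign (s A) + (sign (s B) + ∑ (allFin m) (λ i → pairGain s (bit j i) i)))
  hubGain-split s j = cong (λ P → sign (s E) + (sign (s A) + (sign (s B) + P)))
                           (∑-concatMap (λ i → pairFor (bit j i) i) (allFin m) (sign ∘ s))

  module _ (s : Fin k → Bool) where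

    pairGain-nonneg : s A ≡ true → ∀ b i → 0ℚ ≤ pairGain s b i
    pairGain-nonneg sA zero    i = ≤-refl
    pairGain-nonneg sA (suc _) i rewrite sA with s (T i)
    ... | true  = ≤-by-evaluation _
    ... | false = ≤-by-evaluation _

    pairGain-nonpos : s A ≡ false → ∀ b i → pairGain s b i ≤ 0ℚ
    pairGain-nonpos sA zero    i = ≤-refl
    pairGain-nonpos sA (suc _) i rewrite sA with s (T i)
    ... | true  = ≤-by-evaluation _
    ... | false = ≤-by-evaluation _

    pairGain-zero : s A ≡ true → ∀ {i} → s (T i) ≡ false → ∀ b → pairGain s b i ≡ 0ℚ
    pairGain-zero sA sTᵢ zero    = refl
    pairGain-zero sA sTᵢ (suc _) rewrite sA | sTᵢ = refl

    hubGain<0-A-only : ∀ j → s E ≡ false → s A ≡ true → s B ≡ false →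
                       (∀ i → pairGain s (bit j i) i ≡ 0ℚ) → hubGain s j < 0ℚ
    hubGain<0-A-only j sE sA sB pairs-zero
      rewrite hubGain-split s j | sE | sA | sB | ∑-zero (allFin m) pairs-zero = <-by-evaluation _

    hubGain<0-A-off : ∀ j → s A ≡ false → s E ≡ false ⊎ s B ≡ false → hubGain s j < 0ℚ
    hubGain<0-A-off j sA E∨B rewrite hubGain-split s j | sA =
      ≤-<-trans (+-monoʳ-≤³ (sign (s E)) (sign false) (sign (s B)) pairs≤0) (frame (s E) (s B) E∨B)
      where
      pairs≤0 : ∑ (allFin m) (λ i → pairGain s (bit j i) i) ≤ 0ℚ
      pairs≤0 = ∑-nonpos (allFin m) λ i → pairGain-nonpos sA (bit j i) i
      frame : ∀ e b → e ≡ false ⊎ b ≡ false → sign e + (sign false + (sign b + 0ℚ)) < 0ℚ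
      frame false false _ = <-by-evaluation _
      frame false true  _ = <-by-evaluation _
      frame true  false _ = <-by-evaluation _
      frame true  true  (inj₁ ())
      frame true  true  (inj₂ ())

    hubGain>0-pair : ∀ j i → s E ≡ false → s A ≡ true → s B ≡ false →
                     bit j i ≢ zero → s (T i) ≡ true → 0ℚ < hubGain s j
    hubGain>0-pair j i sE sA sB bitᵢ≢0 sTᵢ rewrite hubGain-split s j | sE | sA | sB =
      <-≤-trans (<-by-evaluation _) (+-monoʳ-≤³ (sign false) (sign true) (sign false) (≤-trans two≤pairᵢ pairᵢ≤pairs))
      where
      two≤pairᵢ : 1ℚ + (1ℚ + 0ℚ) ≤ pairGain s (bit j i) i
      two≤pairᵢ with bit j i
      ... | zero  = contradiction refl bitᵢ≢0
      ... | suc _ rewrite sA | sTᵢ = ≤-refl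
      pairᵢ≤pairs : pairGain s (bit j i) i ≤ ∑ (allFin m) (λ i → pairGain s (bit j i) i)
      pairᵢ≤pairs = term≤∑ (allFin m) (λ i → pairGain-nonneg sA (bit j i) i) (∈-allFin i)

  singleton : Fin k → Fin k → Bool
  singleton t u = does (u ≟ t)

  singleton-nontrivial : ∀ t → NontrivialSide (singleton t)
  singleton-nontrivial zero    = (A , refl) , (B , refl)
  singleton-nontrivial (suc t) = (suc t , dec-true (suc t ≟ suc t) refl) , (A , refl)

  singleton-negative : ∀ t j → hubGain (singleton t) j < 0ℚ
  singleton-negative zero                j =
    hubGain<0-A-only (singleton A) j refl refl refl λ i → pairGain-zero (singleton A) refl refl (bit j i)
  singleton-negative (suc zero)          j = hubGain<0-A-off (singleton B) j refl (inj₁ refl)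
  singleton-negative (suc (suc zero))    j = hubGain<0-A-off (singleton E) j refl (inj₂ refl)
  singleton-negative (suc (suc (suc i))) j = hubGain<0-A-off (singleton (T i)) j refl (inj₁ refl)

  pairSide : Fin m → Fin k → Bool
  pairSide i u = does (u ≟ A) ∨ does (u ≟ T i)

  pairSide-nontrivial : ∀ i → NontrivialSide (pairSide i)
  pairSide-nontrivial i = (A , refl) , (B , refl)

  pairSide-negative : ∀ j i → bit j i ≡ zero → hubGain (pairSide i) j < 0ℚ
  pairSide-negative j i bitᵢ≡0 = hubGain<0-A-only (pairSide i) j refl refl refl pairs-zero
    where
    T-injective : ∀ {i i'} → T i ≡ T i' → i ≡ i'
    T-injective = Finₚ.suc-injective ∘ Finₚ.suc-injective ∘ Finₚ.suc-injective
    pairs-zero : ∀ i' → pairGain (pairSide i) (bit j i') i' ≡ 0ℚ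
    pairs-zero i' with i' ≟ i
    ... | yes refl rewrite bitᵢ≡0 = refl
    ... | no  i'≢i = pairGain-zero (pairSide i) refl (dec-false (T i' ≟ T i) (i'≢i ∘ T-injective)) (bit j i')

  pairSide-positive : ∀ j i → bit j i ≢ zero → 0ℚ < hubGain (pairSide i) j
  pairSide-positive j i bitᵢ≢0 = hubGain>0-pair (pairSide i) j i refl refl refl bitᵢ≢0 (dec-true (T i ≟ T i) refl)

  terminal-or-hub : ∀ x → (∃ λ t → terminal t ≡ x) ⊎ (∃ λ j → hub j ≡ x)
  terminal-or-hub x with Fin.splitAt k x in split
  ... | inj₁ t = inj₁ (t , Finₚ.splitAt⁻¹-↑ˡ split)
  ... | inj₂ j = inj₂ (j , Finₚ.splitAt⁻¹-↑ʳ split)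

  isOne : Fin 2 → Bool
  isOne zero    = false
  isOne (suc _) = true

  isOne-injective : ∀ {a b} → isOne a ≡ isOne b → a ≡ b
  isOne-injective {zero}     {zero}     _ = refl
  isOne-injective {suc zero} {suc zero} _ = refl

  open QuasiBipartiteCuts graph terminal terminal-injective quasiBipartite using (MinimalExtension; minimal-sign)

  hub-negative : ∀ {s σ} → MinimalExtension s σ → ∀ j → hubGain s j < 0ℚ → σ (hub j) ≡ false
  hub-negative {s} {σ} minimal j g<0 =
    proj₁ (minimal-sign {s} {σ} minimal (hub∉T j)) (subst (_< 0ℚ) (sym (gain-hub {s} {σ} (proj₁ minimal) j)) g<0)

  hub-positive : ∀ {s σ} → MinimalExtension s σ → ∀ j → 0ℚ < hubGain s j → σ (hub j) ≡ true
  hub-positive {s} {σ} minimal j 0<g =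
    proj₂ (minimal-sign {s} {σ} minimal (hub∉T j)) (subst (0ℚ <_) (sym (gain-hub {s} {σ} (proj₁ minimal) j)) 0<g)

  module _ {n'} (f : Fin n → Fin n') (partition : IsTerminalSeparatingPartition terminal f)
           (exact : ExactCutSparsifier graph terminal (contract f graph) (f ∘ terminal)) where
    open Contraction graph terminal terminal-injective quasiBipartite positive f partition

    hub≁terminal : ∀ j t → f (hub j) ≢ f (terminal t)
    hub≁terminal j t eq =
      let σ , minimal , constant = exact⇒minimal-constant exact (singleton t) (singleton-nontrivial t)
      in contradiction (begin
        false          ≡⟨ hub-negative {singleton t} {σ} minimal j (singleton-negative t j) ⟨
        σ (hub j)      ≡⟨ constant eq ⟩
        σ (terminal t) ≡⟨ proj₁ minimal t ⟩
        singleton t t  ≡⟨ dec-true (t ≟ t) refl ⟩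
        true           ∎) λ ()
      where open ≡-Reasoning

    hub-bits : ∀ {j j'} → f (hub j) ≡ f (hub j') → bit j ≗ bit j'
    hub-bits {j} {j'} eq i =
      let σ , minimal , constant = exact⇒minimal-constant exact (pairSide i) (pairSide-nontrivial i)
          label : ∀ j → σ (hub j) ≡ isOne (bit j i)
          label j = bit-label {σ} minimal j
      in isOne-injective (trans (sym (label j)) (trans (constant eq) (label j')))
      where
      bit-label : ∀ {σ} → MinimalExtension (pairSide i) σ → ∀ j → σ (hub j) ≡ isOne (bit j i)
      bit-label {σ} minimal j with bit j i in bitᵢ
      ... | zero  = hub-negative {pairSide i} {σ} minimal j (pairSide-negative j i bitᵢ)
      ... | suc _ = hub-positive {pairSide i} {σ} minimal j (pairSide-positive j i λ bitᵢ≡0 → contradiction (trans (sym bitᵢ) bitᵢ≡0) λ ())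

    hub-injective : ∀ {j j'} → f (hub j) ≡ f (hub j') → j ≡ j'
    hub-injective {j} {j'} eq = begin
      j                     ≡⟨ Finₚ.funToFin-finToFin {m} {2} j ⟨
      Fin.funToFin (bit j)  ≡⟨ funToFin-cong {m} {2} (hub-bits eq) ⟩
      Fin.funToFin (bit j') ≡⟨ Finₚ.funToFin-finToFin {m} {2} j' ⟩
      j'                    ∎
      where open ≡-Reasoning

    f-injective : Injective _≡_ _≡_ f
    f-injective {x} {y} eq with terminal-or-hub x | terminal-or-hub y
    ... | inj₁ (t , refl) | inj₁ (t' , refl) = cong terminal (proj₂ partition eq)
    ... | inj₁ (t , refl) | inj₂ (j , refl)  = contradiction (sym eq) (hub≁terminal j t)
    ... | inj₂ (j , refl) | inj₁ (t , refl)  = contradiction eq (hub≁terminal j t)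
    ... | inj₂ (j , refl) | inj₂ (j' , refl) = cong hub (hub-injective eq)

    n≤n' : n ℕ.≤ n'
    n≤n' = Finₚ.injective⇒≤ f-injective

open import Data.Nat using (_≤_; _*_; _+_; _^_; s≤s; z≤n)
open import Data.Nat.Logarithm using (⌊log₂_⌋)
import Data.Nat.Properties as ℕₚ

upper-bound : ∀ (k : ℕ) → 1 ≤ k →
  ∀ (n : ℕ) (G : Graph n) (term : Fin k → Fin n) →
  Injective _≡_ _≡_ term → PositiveWeights G → QuasiBipartite G term →
  Σ ℕ λ n' → Σ (Fin n → Fin n') λ f →
    IsTerminalSeparatingPartition term f ×
    ExactCutSparsifier G term (contract f G) (f ∘ term) ×
    n' ≤ 2 ^ (5 * (k * k * (1 + ⌊log₂ k ⌋)))
upper-bound k 1≤k n G term term-injective pw qb =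
  let n' , f , partition , exact , n'≤classes = UpperBound.sparsifier G term term-injective qb pw
  in n' , f , partition , exact , ℕₚ.≤-trans n'≤classes classes≤
  where
  classes≤ : UpperBound.classCount G term term-injective qb ≤ 2 ^ (5 * (k * k * (1 + ⌊log₂ k ⌋)))
  classes≤ = subst (λ c → k + suc c ^ suc k ≤ 2 ^ (5 * (k * k * (1 + ⌊log₂ k ⌋))))
                   (sym (ChowTheorem.length-cube k)) (SizeBound.class-bound k 1≤k)

HardInstance : ℕ → ℕ → Set
HardInstance d k =
  Σ ℕ λ n → Σ (Graph n) λ G → Σ (Fin k → Fin n) λ term →
    Injective _≡_ _≡_ term × PositiveWeights G × QuasiBipartite G term ×
    (∀ (n' : ℕ) (f : Fin n → Fin n') →
      IsTerminalSeparatingPartition term f →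
      ExactCutSparsifier G term (contract f G) (f ∘ term) →
      2 ^ k ≤ d * n')

edgeless : ∀ k → 2 ^ suc k ≤ 8 → HardInstance 8 (suc k)
edgeless k small = suc k , [] , id , id , [] , [] , λ n' f _ _ → bound n' f
  where bound : ∀ n' → (Fin (suc k) → Fin n') → 2 ^ suc k ≤ 8 * n'
        bound zero     f = contradiction (f zero) Finₚ.¬Fin0
        bound (suc n') f = ℕₚ.≤-trans small (ℕₚ.m≤m*n 8 (suc n'))

-- The gadget of LowerBound needs the three terminals A, B and E.
lower-bound : ∀ k → 1 ≤ k → HardInstance 8 k
lower-bound 1 _ = edgeless 0 (s≤s (s≤s z≤n))
lower-bound 2 _ = edgeless 1 (s≤s (s≤s (s≤s (s≤s z≤n))))
lower-bound (suc (suc (suc m))) _ =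
  n , graph , terminal , terminal-injective , positive , quasiBipartite ,
  λ n' f partition exact → begin
    2 ^ (3 + m)  ≡⟨ ℕₚ.^-distribˡ-+-* 2 3 m ⟩
    8 * 2 ^ m    ≤⟨ ℕₚ.*-monoʳ-≤ 8 (ℕₚ.m≤n+m (2 ^ m) (3 + m)) ⟩
    8 * n        ≤⟨ ℕₚ.*-monoʳ-≤ 8 (n≤n' f partition exact) ⟩
    8 * n'       ∎
  where open LowerBound m
        open ℕₚ.≤-Reasoning

theorem1p2 :
  (Σ ℕ λ C → ∀ (k : ℕ) → 1 ≤ k →
    ∀ (n : ℕ) (G : Graph n) (term : Fin k → Fin n) →
    Injective _≡_ _≡_ term → PositiveWeights G → QuasiBipartite G term →
    Σ ℕ λ n' → Σ (Fin n → Fin n') λ f →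
      IsTerminalSeparatingPartition term f ×
      ExactCutSparsifier G term (contract f G) (f ∘ term) ×
      n' ≤ 2 ^ (C * (k * k * (1 + ⌊log₂ k ⌋))))
  ×
  (Σ ℕ λ d → 1 ≤ d × (∀ (k : ℕ) → 1 ≤ k →
    Σ ℕ λ n → Σ (Graph n) λ G → Σ (Fin k → Fin n) λ term →
      Injective _≡_ _≡_ term × PositiveWeights G × QuasiBipartite G term ×
      (∀ (n' : ℕ) (f : Fin n → Fin n') →
        IsTerminalSeparatingPartition term f →
        ExactCutSparsifier G term (contract f G) (f ∘ term) →
        2 ^ k ≤ d * n')))
theorem1p2 = (5 , upper-bound) , (8 , s≤s z≤n , lower-bound)
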